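{- Let $G$, $s$, $T$ and the labels $\ell(\cdot)$ be as produced by the Mark-up algorithm described in the context. Let $e=(u,v)\in E(T)$ and let $t$ be a vertex with $\ell(t)=e$. Then any shortest path $\pi_{G-e}(s,t)$ from $s$ to $t$ in $G-e$ and the tree path $\pi_T(v,t)$ are edge-disjoint.
   Context: $G$ is an undirected 2-edge-connected graph with non-negative real edge weights, $s\in V(G)$, and $T$ is a fixed shortest-path tree of $G$ rooted at $s$. $d_H(x,y)$ is the shortest-path distance in $H$; $G-e$ is $G$ minus edge $e$. For $e=(u,v)\in E(T)$, $u$ is the parent of $v$; $T_v$ is the subtree of $T$ rooted at $v$; for $t\in V(T_v)$, $A(t,e)=V(\pi_T(v,t))$ is the set of vertices on the tree path from $v$ to $t$ (including $v$ and $t$); $P_e(t)$ is the path $\pi_{G-e}(s,v)\circ\pi_T(v,t)$, of weight $w(P_e(t))=d_{G-e}(s,v)+d_G(v,t)$. The total order $\prec$ on $E(T)$ is the order in which a preorder visit of $T$ from $s$ traverses the edges; a special label $\infty$ satisfies $e'\prec\infty$ for all $e'\in E(T)$. Mark-up algorithm: initially $\ell(x)=\infty$ for all vertices $x$. For each $e=(u,v)\in E(T)$ in order $\prec$, and for each $t\in V(T_v)$ in preorder of $T$: if $w(P_e(t))\le 2d_{G-e}(s,t)$ (distance test) do nothing; else if some $z\in A(t,e)$ has $\ell(z)\ne\infty$ (ancestor test) do nothing; otherwise set $\ell(t)\gets e$.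
   Formalization: The edge weights of G are non-negative rationals instead of non-negative reals. -}

module Defs where

open import Level using (0ℓ)
open import Data.Nat using (ℕ; zero; suc)
open import Data.Fin using (Fin; _≟_)
open import Data.Rational using (ℚ; 0ℚ; _+_; _≤_)
open import Data.List using (List; []; _∷_; _++_; head; last)
open import Data.List.Membership.Propositional using (_∈_)
open import Data.List.Relation.Unary.Unique.Propositional using (Unique)
open import Data.Maybe using (Maybe; just; nothing)
open import Data.Product using (Σ; ∃; _×_; _,_)
open import Data.Sum using (_⊎_)
open import Relation.Nullary using (¬_; yes; no)
open import Relation.Binary.PropositionalEquality using (_≡_; _≢_)
open import Function.Bundles using (_⇔_)

Rel : ℕ → Set₁
Rel n = Fin n → Fin n → Set

SameEdge : ∀ {n} → Fin n → Fin n → Fin n → Fin n → Set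
SameEdge a b c d = (a ≡ c × b ≡ d) ⊎ (a ≡ d × b ≡ c)

record Graph (n : ℕ) : Set₁ where
  field
    E        : Rel n
    E-sym    : ∀ {x y} → E x y → E y x
    E-irrefl : ∀ {x} → ¬ E x x
    w        : Fin n → Fin n → ℚ
    w-sym    : ∀ x y → w x y ≡ w y x
    w-nonneg : ∀ x y → 0ℚ ≤ w x y
open Graph public

Remove : ∀ {n} → Rel n → Fin n → Fin n → Rel n
Remove R a b x y = R x y × ¬ SameEdge x y a b

data Chain {n} (R : Rel n) : List (Fin n) → Set where
  one  : ∀ x → Chain R (x ∷ [])
  cons : ∀ {x y l} → R x y → Chain R (y ∷ l) → Chain R (x ∷ y ∷ l)

Path : ∀ {n} → Rel n → Fin n → Fin n → List (Fin n) → Set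
Path R x y p = Chain R p × head p ≡ just x × last p ≡ just y × Unique p

wt : ∀ {n} → (Fin n → Fin n → ℚ) → List (Fin n) → ℚ
wt w (x ∷ y ∷ l) = w x y + wt w (y ∷ l)
wt w _           = 0ℚ

IsShortest : ∀ {n} → Rel n → (Fin n → Fin n → ℚ) → Fin n → Fin n → List (Fin n) → Set
IsShortest R w x y p = Path R x y p × (∀ q → Path R x y q → wt w p ≤ wt w q)

IsDist : ∀ {n} → Rel n → (Fin n → Fin n → ℚ) → Fin n → Fin n → ℚ → Set
IsDist R w x y r =
  (∃ λ p → Path R x y p × wt w p ≡ r) × (∀ q → Path R x y q → r ≤ wt w q)

Connected : ∀ {n} → Rel n → Set
Connected R = ∀ x y → ∃ λ p → Path R x y p

TwoEdgeConnected : ∀ {n} → Graph n → Set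
TwoEdgeConnected G =
  Connected (E G) × (∀ a b → E G a b → Connected (Remove (E G) a b))

data Consec {n} : List (Fin n) → Fin n → Fin n → Set where
  here  : ∀ {x y l} → Consec (x ∷ y ∷ l) x y
  there : ∀ {x l a b} → Consec l a b → Consec (x ∷ l) a b

EdgeDisjoint : ∀ {n} → List (Fin n) → List (Fin n) → Set
EdgeDisjoint p q = ∀ a b c d → Consec p a b → Consec q c d → ¬ SameEdge a b c d

-- Spanning tree rooted at s, given by a parent function; the edge of T
-- entering v ≠ s is (parent v, v); depth guarantees acyclicity.

record RootedTree {n} (G : Graph n) (s : Fin n) : Set where
  field
    parent      : Fin n → Fin n
    depth       : Fin n → ℕ
    depth-root  : depth s ≡ 0
    depth-step  : ∀ v → v ≢ s → depth v ≡ suc (depth (parent v))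
    parent-edge : ∀ v → v ≢ s → E G (parent v) v
open RootedTree public

module _ {n} {G : Graph n} {s : Fin n} (T : RootedTree G s) where

  TE : Rel n
  TE x y = (y ≢ s × parent T y ≡ x) ⊎ (x ≢ s × parent T x ≡ y)

  IsSPT : Set
  IsSPT = ∀ v p → Path TE s v p → IsShortest (E G) (w G) s v p

  -- Desc v t  :  t ∈ V(T_v)
  data Desc (v : Fin n) : Fin n → Set where
    self : Desc v v
    down : ∀ {t} → t ≢ s → Desc v (parent T t) → Desc v t

  -- z ∈ A(t,e) for e = (parent v, v)
  InA : Fin n → Fin n → Fin n → Set
  InA v t z = Desc v z × Desc z t

  -- preorder listings of subtrees (children visited in any order)
  data PreList : Fin n → List (Fin n) → Set
  data Forest  : List (Fin n) → List (Fin n) → Set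

  data PreList where
    node : ∀ {v cs ls} → Unique cs →
           (∀ c → (c ∈ cs) ⇔ (c ≢ s × parent T c ≡ v)) →
           Forest cs ls → PreList v (v ∷ ls)

  data Forest where
    []  : Forest [] []
    _∷_ : ∀ {c cs l ls} → PreList c l → Forest cs ls → Forest (c ∷ cs) (l ++ ls)

-- Mark-up algorithm.  A label is Maybe (Fin n): nothing = ∞,
-- just v = the tree edge (parent v, v).

Label : ℕ → Set
Label n = Fin n → Maybe (Fin n)

update : ∀ {n} → Label n → Fin n → Maybe (Fin n) → Label n
update ℓ t a x with x ≟ t
... | yes _ = a
... | no  _ = ℓ x

module MarkUp {n} {G : Graph n} {s : Fin n} (T : RootedTree G s)
              (dG : Fin n → Fin n → ℚ)
              (dGe : Fin n → Fin n → Fin n → ℚ)  -- dGe v x y = d_{G-(parent v,v)}(x,y)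
              where

  -- w(P_e(t)) for e = (parent v, v)
  wP : Fin n → Fin n → ℚ
  wP v t = dGe v s v + dG v t

  DistTest : Fin n → Fin n → Set
  DistTest v t = wP v t ≤ dGe v s t + dGe v s t

  -- inner loop for e = (parent v, v): t ranges over the preorder list,
  -- vertices outside T_v are skipped (so T_v is scanned in preorder)
  data Inner (v : Fin n) : Label n → List (Fin n) → Label n → Set where
    done    : ∀ {ℓ} → Inner v ℓ [] ℓ
    notDesc : ∀ {ℓ t ts ℓ'} → ¬ Desc T v t → Inner v ℓ ts ℓ' → Inner v ℓ (t ∷ ts) ℓ'
    distOK  : ∀ {ℓ t ts ℓ'} → Desc T v t → DistTest v t →
              Inner v ℓ ts ℓ' → Inner v ℓ (t ∷ ts) ℓ'
    ancHit  : ∀ {ℓ t ts ℓ'} → Desc T v t → ¬ DistTest v t →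
              (∃ λ z → InA T v t z × ℓ z ≢ nothing) →
              Inner v ℓ ts ℓ' → Inner v ℓ (t ∷ ts) ℓ'
    mark    : ∀ {ℓ t ts ℓ'} → Desc T v t → ¬ DistTest v t →
              (∀ z → InA T v t z → ℓ z ≡ nothing) →
              Inner v (update ℓ t (just v)) ts ℓ' → Inner v ℓ (t ∷ ts) ℓ'

  -- outer loop: edges in order ≺, i.e. child endpoints in preorder
  data Outer (L : List (Fin n)) : Label n → List (Fin n) → Label n → Set where
    done : ∀ {ℓ} → Outer L ℓ [] ℓ
    root : ∀ {ℓ vs ℓ'} → Outer L ℓ vs ℓ' → Outer L ℓ (s ∷ vs) ℓ'
    edge : ∀ {ℓ v vs ℓ₁ ℓ'} → v ≢ s → Inner v ℓ L ℓ₁ →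
           Outer L ℓ₁ vs ℓ' → Outer L ℓ (v ∷ vs) ℓ'

  Result : List (Fin n) → Label n → Set
  Result L ℓ = Outer L (λ _ → nothing) L ℓ

{-# OPTIONS --safe #-}
-- Suppose the shortest path q in G − e and the tree path π_T(v,t) share an edge. One of its
-- endpoints z ≠ t lies on both, so z is a proper ancestor of t inside T_v and is scanned before t.
-- Because the ancestor test did not fire at t, z was neither marked nor blocked by a marked
-- ancestor, hence z passed the distance test: w(P_e(z)) ≤ 2 d_{G−e}(s,z). Since z lies on q,
-- d_{G−e}(s,t) = d_{G−e}(s,z) + d_{G−e}(z,t), and with d(v,t) ≤ d(v,z) + d(z,t) ≤ d(v,z) + d_{G−e}(z,t)
-- this gives w(P_e(t)) ≤ 2 d_{G−e}(s,t): t passes the distance test and could not have been marked.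
module Submission where

open import Defs
open import Algebra.Bundles using (CommutativeMonoid)
import Algebra.Properties.CommutativeSemigroup as CommutativeSemigroupProperties
open import Data.Empty using (⊥; ⊥-elim)
open import Data.Fin using (Fin) renaming (_≟_ to _≟F_)
open import Data.List using (List; []; _∷_; _++_; head; last)
open import Data.List.Properties using (∷-injective)
open import Data.List.Membership.Propositional using (_∈_)
open import Data.List.Membership.Propositional.Properties using (∈-++⁺ʳ)
import Data.List.Membership.DecPropositional as DecMembership
open import Data.List.Relation.Unary.Any using (here; there)
open import Data.List.Relation.Unary.All using ([]; _∷_)
open import Data.List.Relation.Unary.All.Properties using (¬Any⇒All¬; All¬⇒¬Any)
open import Data.List.Relation.Unary.AllPairs using ([]; _∷_)
open import Data.List.Relation.Unary.Unique.Propositional using (Unique)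
open import Data.Maybe using (just; nothing)
open import Data.Maybe.Properties using (just-injective)
open import Data.Nat using () renaming (_≤_ to _≤ℕ_)
import Data.Nat.Properties as ℕ
open import Data.Product using (∃; ∃₂; _×_; _,_; proj₁; proj₂)
open import Data.Rational using (ℚ; 0ℚ; _+_; _≤_)
import Data.Rational.Properties as ℚ
open import Data.Sum using (_⊎_; inj₁; inj₂)
open import Function.Bundles using (Equivalence)
open import Relation.Nullary using (¬_; yes; no)
open import Relation.Binary.PropositionalEquality

p≤p+q : ∀ {p q} → 0ℚ ≤ q → p ≤ p + q
p≤p+q {p} {q} 0≤q = subst (_≤ p + q) (ℚ.+-identityʳ p) (ℚ.+-monoʳ-≤ p 0≤q)

p≤q+p : ∀ {p q} → 0ℚ ≤ q → p ≤ q + p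
p≤q+p {p} {q} 0≤q = subst (_≤ q + p) (ℚ.+-identityˡ p) (ℚ.+-monoˡ-≤ p 0≤q)

open CommutativeSemigroupProperties
  (CommutativeMonoid.commutativeSemigroup ℚ.+-0-commutativeMonoid)
  using (interchange)

occurrence-in-++ : ∀ {a} {A : Set a} (l ls pre : List A) t post →
  l ++ ls ≡ pre ++ t ∷ post →
  (∃ λ post₁ → l ≡ pre ++ t ∷ post₁) ⊎ (∃ λ pre₂ → pre ≡ l ++ pre₂ × ls ≡ pre₂ ++ t ∷ post)
occurrence-in-++ []      ls pre       t post eq   = inj₂ (pre , refl , eq)
occurrence-in-++ (x ∷ l) ls []        t post refl = inj₁ (l , refl)
occurrence-in-++ (x ∷ l) ls (y ∷ pre) t post eq with ∷-injective eq
... | refl , eq′ with occurrence-in-++ l ls pre t post eq′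
...   | inj₁ (post₁ , e)     = inj₁ (post₁ , cong (x ∷_) e)
...   | inj₂ (pre₂ , e₁ , e₂) = inj₂ (pre₂ , cong (x ∷_) e₁ , e₂)

Walk : ∀ {n} → Rel n → Fin n → Fin n → List (Fin n) → Set
Walk R x y l = Chain R l × head l ≡ just x × last l ≡ just y

path⇒walk : ∀ {n} {R : Rel n} {x y p} → Path R x y p → Walk R x y p
path⇒walk (c , h , l , _) = c , h , l

chain-map : ∀ {n} {R R′ : Rel n} → (∀ {x y} → R x y → R′ x y) →
            ∀ {l} → Chain R l → Chain R′ l
chain-map f (one x)    = one x
chain-map f (cons r c) = cons (f r) (chain-map f c)

consec⇒edge : ∀ {n} {R : Rel n} {l a b} → Chain R l → Consec l a b → R a b
consec⇒edge (cons r c) here      = r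
consec⇒edge (cons r c) (there k) = consec⇒edge c k

consec-∈ˡ : ∀ {n} {l : List (Fin n)} {a b} → Consec l a b → a ∈ l
consec-∈ˡ here      = here refl
consec-∈ˡ (there k) = there (consec-∈ˡ k)

consec-∈ʳ : ∀ {n} {l : List (Fin n)} {a b} → Consec l a b → b ∈ l
consec-∈ʳ here      = there (here refl)
consec-∈ʳ (there k) = there (consec-∈ʳ k)

sameEdge-∈ : ∀ {n} {l : List (Fin n)} {a b c d} →
             Consec l a b → SameEdge a b c d → c ∈ l × d ∈ l
sameEdge-∈ k (inj₁ (refl , refl)) = consec-∈ˡ k , consec-∈ʳ k
sameEdge-∈ k (inj₂ (refl , refl)) = consec-∈ʳ k , consec-∈ˡ k

shared-edge⇒shared-vertex : ∀ {n} {p q : List (Fin n)} {a b c d} t →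
  Consec q a b → Consec p c d → SameEdge a b c d → c ≢ d →
  ∃ λ z → z ∈ p × z ∈ q × z ≢ t
shared-edge⇒shared-vertex {c = c} {d} t ab∈q cd∈p ab~cd c≢d with c ≟F t
... | yes refl = d , consec-∈ʳ cd∈p , proj₂ (sameEdge-∈ ab∈q ab~cd) , λ d≡c → c≢d (sym d≡c)
... | no  c≢t  = c , consec-∈ˡ cd∈p , proj₁ (sameEdge-∈ ab∈q ab~cd) , c≢t

dist-mono : ∀ {n} {R R′ : Rel n} {ω x y r r′} → (∀ {a b} → R a b → R′ a b) →
            IsDist R′ ω x y r′ → IsDist R ω x y r → r′ ≤ r
dist-mono R⊆R′ (_ , r′-min) ((p , (c , P) , refl) , _) = r′-min p (chain-map R⊆R′ c , P)

module WeightedWalks {n} (R : Rel n) (ω : Fin n → Fin n → ℚ)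
                     (ω≥0 : ∀ x y → 0ℚ ≤ ω x y) where
  open DecMembership (_≟F_ {n}) using (_∈?_)

  wt-nonNeg : ∀ l → 0ℚ ≤ wt ω l
  wt-nonNeg []          = ℚ.≤-refl
  wt-nonNeg (x ∷ [])    = ℚ.≤-refl
  wt-nonNeg (x ∷ y ∷ l) = ℚ.≤-trans (wt-nonNeg (y ∷ l)) (p≤q+p (ω≥0 x y))

  dist-nonNeg : ∀ {x y r} → IsDist R ω x y r → 0ℚ ≤ r
  dist-nonNeg ((p , _ , refl) , _) = wt-nonNeg p

  path-suffix : ∀ {x y z} p → Path R x z p → y ∈ p →
                ∃ λ p′ → Path R y z p′ × wt ω p′ ≤ wt ω p
  path-suffix (x ∷ l) P@(_ , refl , _) (here refl) = x ∷ l , P , ℚ.≤-refl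
  path-suffix (x ∷ x′ ∷ l) (cons r c , refl , la , _ ∷ u) (there m)
    with path-suffix (x′ ∷ l) (c , refl , la , u) m
  ... | p′ , P′ , le = p′ , P′ , ℚ.≤-trans le (p≤q+p (ω≥0 x x′))

  prepend-path : ∀ {x y z p} → R x y → Path R y z p →
                 ∃ λ p′ → Path R x z p′ × wt ω p′ ≤ ω x y + wt ω p
  prepend-path {p = []} r (_ , () , _)
  prepend-path {x} {y} {p = y ∷ l} r P@(c , refl , la , u) with x ∈? (y ∷ l)
  ... | no x∉p  = x ∷ y ∷ l , (cons r c , refl , la , ¬Any⇒All¬ _ x∉p ∷ u) , ℚ.≤-refl
  ... | yes x∈p with path-suffix (y ∷ l) P x∈p
  ...   | p′ , P′ , le = p′ , P′ , ℚ.≤-trans le (p≤q+p (ω≥0 x y))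

  walk⇒path : ∀ {x y} l → Walk R x y l → ∃ λ p → Path R x y p × wt ω p ≤ wt ω l
  walk⇒path (x ∷ []) (one x , refl , refl) =
    x ∷ [] , (one x , refl , refl , [] ∷ []) , ℚ.≤-refl
  walk⇒path (x ∷ x′ ∷ l) (cons r c , refl , la) =
    let p , P , p≤l = walk⇒path (x′ ∷ l) (c , refl , la)
        p′ , P′ , p′≤p = prepend-path r P
    in p′ , P′ , ℚ.≤-trans p′≤p (ℚ.+-monoʳ-≤ (ω x x′) p≤l)

  dist≤walk : ∀ {x y r} l → IsDist R ω x y r → Walk R x y l → r ≤ wt ω l
  dist≤walk l (_ , r-min) W = let p , P , p≤l = walk⇒path l W in ℚ.≤-trans (r-min p P) p≤l

  wt-cons-assoc : ∀ x x′ l a → ω x x′ + (wt ω (x′ ∷ l) + a) ≡ wt ω (x ∷ x′ ∷ l) + a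
  wt-cons-assoc x x′ l a = sym (ℚ.+-assoc (ω x x′) (wt ω (x′ ∷ l)) a)

  walk-++ : ∀ {x y z} l₁ {l₂} → Walk R x y l₁ → Walk R y z l₂ →
            ∃ λ l → Walk R x z l × wt ω l ≡ wt ω l₁ + wt ω l₂
  walk-++ (x ∷ []) (one x , refl , refl) W₂ = _ , W₂ , sym (ℚ.+-identityˡ _)
  walk-++ (x ∷ x′ ∷ l) {l₂} (cons r c , refl , la) W₂ with walk-++ (x′ ∷ l) (c , refl , la) W₂
  ... | [] , (_ , () , _) , _
  ... | x′ ∷ m , (c′ , refl , la′) , e =
    x ∷ x′ ∷ m , (cons r c′ , refl , la′) ,
    trans (cong (ω x x′ +_) e) (wt-cons-assoc x x′ l (wt ω l₂))

  walk-split : ∀ {x y z} l → Walk R x y l → z ∈ l →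
    ∃₂ λ l₁ l₂ → Walk R x z l₁ × Walk R z y l₂ × wt ω l ≡ wt ω l₁ + wt ω l₂
  walk-split (x ∷ l) W@(_ , refl , _) (here refl) =
    x ∷ [] , x ∷ l , (one x , refl , refl) , W , sym (ℚ.+-identityˡ _)
  walk-split (x ∷ x′ ∷ l) (cons r c , refl , la) (there m)
    with walk-split (x′ ∷ l) (c , refl , la) m
  ... | [] , _ , (_ , () , _) , _
  ... | x′ ∷ l₁ , l₂ , (c₁ , refl , la₁) , W₂ , e =
    x ∷ x′ ∷ l₁ , l₂ , (cons r c₁ , refl , la₁) , W₂ ,
    trans (cong (ω x x′ +_) e) (wt-cons-assoc x x′ l₁ (wt ω l₂))

  dist-triangle : ∀ {x y z a b c} → IsDist R ω x y a → IsDist R ω y z b →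
                  IsDist R ω x z c → c ≤ a + b
  dist-triangle ((p , P , refl) , _) ((q , Q , refl) , _) Dxz =
    let l , W , e = walk-++ p (path⇒walk P) (path⇒walk Q)
    in subst (_ ≤_) e (dist≤walk l Dxz W)

  dist-through : ∀ {x y z a b} l → IsDist R ω x z a → IsDist R ω z y b →
                 Walk R x y l → z ∈ l → a + b ≤ wt ω l
  dist-through l Dxz Dzy W z∈l =
    let l₁ , l₂ , W₁ , W₂ , e = walk-split l W z∈l
    in subst (_ ≤_) (sym e) (ℚ.+-mono-≤ (dist≤walk l₁ Dxz W₁) (dist≤walk l₂ Dzy W₂))

module _ {n} {G : Graph n} {s : Fin n} (T : RootedTree G s) where

  Child : Rel n
  Child x y = y ≢ s × parent T y ≡ x

  child⇒desc : ∀ {x y} → Child x y → Desc T x y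
  child⇒desc (y≢s , refl) = down y≢s self

  desc-trans : ∀ {a b c} → Desc T a b → Desc T b c → Desc T a c
  desc-trans a≼b self           = a≼b
  desc-trans a≼b (down c≢s b≼p) = down c≢s (desc-trans a≼b b≼p)

  desc-parent : ∀ {z c} → Desc T z c → z ≢ c → Desc T z (parent T c)
  desc-parent self         z≢z = ⊥-elim (z≢z refl)
  desc-parent (down _ z≼p) _   = z≼p

  desc-depth : ∀ {v z} → Desc T v z → depth T v ≤ℕ depth T z
  desc-depth self = ℕ.≤-refl
  desc-depth (down {t} t≢s v≼p) rewrite depth-step T t t≢s = ℕ.m≤n⇒m≤1+n (desc-depth v≼p)

  ¬desc-parent : ∀ {v} → v ≢ s → ¬ Desc T v (parent T v)
  ¬desc-parent {v} v≢s v≼p with desc-depth v≼p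
  ... | le rewrite depth-step T v v≢s = ℕ.<-irrefl refl le

  ¬proper-ancestor-root : ∀ {z} → Desc T z s → z ≢ s → ⊥
  ¬proper-ancestor-root {z} z≼s z≢s with desc-depth z≼s
  ... | le rewrite depth-step T z z≢s | depth-root T = ℕ.n≮0 le

  TE⇒≢ : ∀ {x y} → TE T x y → x ≢ y
  TE⇒≢ (inj₁ (y≢s , py≡x)) refl = ¬desc-parent y≢s (subst (Desc T _) (sym py≡x) self)
  TE⇒≢ (inj₂ (x≢s , px≡y)) refl = ¬desc-parent x≢s (subst (Desc T _) (sym px≡y) self)

  -- The only tree edge between T_v and the rest of T is (parent v, v).
  tree-chain-into-subtree : ∀ {v t} y l → Chain (TE T) (y ∷ l) → last (y ∷ l) ≡ just t →
                            Desc T v t → v ∈ y ∷ l ⊎ Desc T v y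
  tree-chain-into-subtree y [] (one y) refl v≼t = inj₂ v≼t
  tree-chain-into-subtree {v} y (y′ ∷ l) (cons e c) la v≼t
    with tree-chain-into-subtree y′ l c la v≼t
  ... | inj₁ v∈l = inj₁ (there v∈l)
  ... | inj₂ v≼y′ with e
  ...   | inj₂ (y≢s , py≡y′) = inj₂ (down y≢s (subst (Desc T v) (sym py≡y′) v≼y′))
  ...   | inj₁ (_ , py′≡y) with y′ ≟F v
  ...     | yes refl  = inj₁ (there (here refl))
  ...     | no  y′≢v = inj₂ (subst (Desc T v) py′≡y (desc-parent v≼y′ λ v≡y′ → y′≢v (sym v≡y′)))

  descending : ∀ {x y} l → Chain (TE T) (x ∷ y ∷ l) → Unique (x ∷ y ∷ l) →
               Child x y → Chain Child (x ∷ y ∷ l)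
  descending [] (cons _ (one _)) _ x→y = cons x→y (one _)
  descending (z ∷ l) (cons _ c@(cons e _)) ((_ ∷ x≢z ∷ _) ∷ u) x→y with e
  ... | inj₁ y→z        = cons x→y (descending l c u y→z)
  ... | inj₂ (_ , py≡z) = ⊥-elim (x≢z (trans (sym (proj₂ x→y)) py≡z))

  descending⇒InA : ∀ {x t z} l → Chain Child (x ∷ l) → last (x ∷ l) ≡ just t →
                   z ∈ x ∷ l → InA T x t z
  descending⇒InA [] (one _) refl (here refl) = self , self
  descending⇒InA (x′ ∷ l) (cons x→x′ c) la (here refl) =
    self , desc-trans (child⇒desc x→x′) (proj₂ (descending⇒InA l c la (here refl)))
  descending⇒InA (x′ ∷ l) (cons x→x′ c) la (there z∈l) =
    let x′≼z , z≼t = descending⇒InA l c la z∈l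
    in desc-trans (child⇒desc x→x′) x′≼z , z≼t

  tree-path-InA : ∀ {v t z p} → Path (TE T) v t p → Desc T v t → z ∈ p → InA T v t z
  tree-path-InA {p = v ∷ []} (one _ , refl , refl , _) _ (here refl) = self , self
  tree-path-InA {p = v ∷ y ∷ l} (cons (inj₁ v→y) c , refl , la , u) _ z∈p =
    descending⇒InA (y ∷ l) (descending l (cons (inj₁ v→y) c) u v→y) la z∈p
  tree-path-InA {p = v ∷ y ∷ l} (cons (inj₂ (v≢s , pv≡y)) c , refl , la , v∉l ∷ _) v≼t _
    with tree-chain-into-subtree y l c la v≼t
  ... | inj₁ v∈l = ⊥-elim (All¬⇒¬Any v∉l v∈l)
  ... | inj₂ v≼y = ⊥-elim (¬desc-parent v≢s (subst (Desc T v) (sym pv≡y) v≼y))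

  mutual
    preorder-ancestors-first : ∀ {r L} → PreList T r L → ∀ pre t post → L ≡ pre ++ t ∷ post →
      ∀ {z} → Desc T z t → z ≢ t → z ∈ pre ⊎ (Desc T z r × z ≢ r)
    preorder-ancestors-first (node _ _ _) [] t post refl z≼t z≢t = inj₂ (z≼t , z≢t)
    preorder-ancestors-first {r} (node _ children F) (x ∷ pre) t post refl {z} z≼t z≢t
      with forest-ancestors-first (λ c c∈cs → proj₂ (Equivalence.to (children c) c∈cs))
                                  F pre t post refl z≼t z≢t
    ... | inj₁ z∈pre = inj₁ (there z∈pre)
    ... | inj₂ z≼r with z ≟F r
    ...   | yes z≡r = inj₁ (here z≡r)
    ...   | no  z≢r = inj₂ (z≼r , z≢r)

    forest-ancestors-first : ∀ {r cs ls} → (∀ c → c ∈ cs → parent T c ≡ r) → Forest T cs ls →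
      ∀ pre t post → ls ≡ pre ++ t ∷ post →
      ∀ {z} → Desc T z t → z ≢ t → z ∈ pre ⊎ Desc T z r
    forest-ancestors-first _ [] [] _ _ ()
    forest-ancestors-first _ [] (_ ∷ _) _ _ ()
    forest-ancestors-first parent≡r (_∷_ {c} {l = l} {ls} P F) pre t post eq {z} z≼t z≢t
      with occurrence-in-++ l ls pre t post eq
    ... | inj₁ (post₁ , e) with preorder-ancestors-first P pre t post₁ e z≼t z≢t
    ...   | inj₁ z∈pre        = inj₁ z∈pre
    ...   | inj₂ (z≼c , z≢c) =
      inj₂ (subst (Desc T z) (parent≡r c (here refl)) (desc-parent z≼c z≢c))
    forest-ancestors-first parent≡r (_∷_ {l = l} P F) pre t post eq z≼t z≢t
        | inj₂ (pre₂ , e₁ , e₂)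
      with forest-ancestors-first (λ c c∈cs → parent≡r c (there c∈cs)) F pre₂ t post e₂ z≼t z≢t
    ...   | inj₁ z∈pre₂ = inj₁ (subst (_ ∈_) (sym e₁) (∈-++⁺ʳ l z∈pre₂))
    ...   | inj₂ z≼r    = inj₂ z≼r

update-self : ∀ {n} (ℓ : Label n) t a → update ℓ t a t ≡ a
update-self ℓ t a with t ≟F t
... | yes _   = refl
... | no  t≢t = ⊥-elim (t≢t refl)

update-other : ∀ {n} (ℓ : Label n) t a x → x ≢ t → update ℓ t a x ≡ ℓ x
update-other ℓ t a x x≢t with x ≟F t
... | yes x≡t = ⊥-elim (x≢t x≡t)
... | no  _   = refl

just≢nothing : ∀ {a} {A : Set a} {x : A} → just x ≢ nothing
just≢nothing ()

_⊑_ : ∀ {n} → Label n → Label n → Set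
ℓ ⊑ ℓ′ = ∀ {t a} → ℓ t ≡ just a → ℓ′ t ≡ just a

⊑-labelled : ∀ {n} {ℓ ℓ′ : Label n} → ℓ ⊑ ℓ′ → ∀ {t} → ℓ t ≢ nothing → ℓ′ t ≢ nothing
⊑-labelled {ℓ = ℓ} ℓ⊑ℓ′ {t} labelled with ℓ t in eq
... | nothing = ⊥-elim (labelled refl)
... | just a  = λ unlabelled → just≢nothing (trans (sym (ℓ⊑ℓ′ eq)) unlabelled)

module MarkUpRun {n} {G : Graph n} {s : Fin n} (T : RootedTree G s)
                 (dG : Fin n → Fin n → ℚ) (dGe : Fin n → Fin n → Fin n → ℚ) where
  open MarkUp T dG dGe

  inner-⊑ : ∀ {v ℓ xs ℓ′} → Inner v ℓ xs ℓ′ → ℓ ⊑ ℓ′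
  inner-⊑ done                  e = e
  inner-⊑ (notDesc _ r)         e = inner-⊑ r e
  inner-⊑ (distOK _ _ r)        e = inner-⊑ r e
  inner-⊑ (ancHit _ _ _ r)      e = inner-⊑ r e
  inner-⊑ {v} {ℓ} (mark {t = x} x∈Tv _ unlabelled r) {t} e with t ≟F x
  ... | yes refl = ⊥-elim (just≢nothing (trans (sym e) (unlabelled t (x∈Tv , self))))
  ... | no  t≢x  = inner-⊑ r (trans (update-other ℓ x (just v) t t≢x) e)

  outer-⊑ : ∀ {L ℓ vs ℓ′} → Outer L ℓ vs ℓ′ → ℓ ⊑ ℓ′
  outer-⊑ done         e = e
  outer-⊑ (root o)     e = outer-⊑ o e
  outer-⊑ (edge _ i o) e = outer-⊑ o (inner-⊑ i e)

  record MarkingStep (v : Fin n) (ℓ : Label n) (xs : List (Fin n)) (t : Fin n) : Set where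
    field
      pre post      : List (Fin n)
      xs≡pre+t+post : xs ≡ pre ++ t ∷ post
      ℓ₀            : Label n
      run-pre       : Inner v ℓ pre ℓ₀
      t∈Tv          : Desc T v t
      fails-test    : ¬ DistTest v t
      A-unlabelled  : ∀ z → InA T v t z → ℓ₀ z ≡ nothing

  step-before : ∀ {v ℓ ℓ₁ x xs t} →
    (∀ {ys ℓ₀} → Inner v ℓ₁ ys ℓ₀ → Inner v ℓ (x ∷ ys) ℓ₀) →
    MarkingStep v ℓ₁ xs t → MarkingStep v ℓ (x ∷ xs) t
  step-before {x = x} step m = record
    { pre = x ∷ pre ; post = post ; xs≡pre+t+post = cong (x ∷_) xs≡pre+t+post
    ; ℓ₀ = ℓ₀ ; run-pre = step run-pre
    ; t∈Tv = t∈Tv ; fails-test = fails-test ; A-unlabelled = A-unlabelled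
    }
    where open MarkingStep m

  inner-marking-step : ∀ {v ℓ xs ℓ′ t a} → Inner v ℓ xs ℓ′ →
    ℓ t ≡ nothing → ℓ′ t ≡ just a → a ≡ v × MarkingStep v ℓ xs t
  inner-marking-step done e₁ e₂ = ⊥-elim (just≢nothing (trans (sym e₂) e₁))
  inner-marking-step (notDesc x∉Tv r) e₁ e₂ =
    let a≡v , m = inner-marking-step r e₁ e₂ in a≡v , step-before (notDesc x∉Tv) m
  inner-marking-step (distOK x∈Tv passes r) e₁ e₂ =
    let a≡v , m = inner-marking-step r e₁ e₂ in a≡v , step-before (distOK x∈Tv passes) m
  inner-marking-step (ancHit x∈Tv fails hit r) e₁ e₂ =
    let a≡v , m = inner-marking-step r e₁ e₂ in a≡v , step-before (ancHit x∈Tv fails hit) m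
  inner-marking-step {v} {ℓ} {t = t} (mark {t = x} {ts = ts} x∈Tv fails unlabelled r) e₁ e₂
    with x ≟F t
  ... | yes refl =
    just-injective (trans (sym e₂) (inner-⊑ r (update-self ℓ t (just v)))) ,
    record { pre = [] ; post = ts ; xs≡pre+t+post = refl ; ℓ₀ = ℓ ; run-pre = done
           ; t∈Tv = x∈Tv ; fails-test = fails ; A-unlabelled = unlabelled }
  ... | no x≢t =
    let t≢x = λ t≡x → x≢t (sym t≡x)
        a≡v , m = inner-marking-step r (trans (update-other ℓ x (just v) t t≢x) e₁) e₂
    in a≡v , step-before (mark x∈Tv fails unlabelled) m

  inner-ancestors-pass : ∀ {v ℓ pre ℓ₀ t} → Inner v ℓ pre ℓ₀ →
    (∀ z → InA T v t z → ℓ₀ z ≡ nothing) → ∀ {z} → z ∈ pre → InA T v t z → DistTest v z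
  inner-ancestors-pass (notDesc z∉Tv _) _ (here refl) (v≼z , _) = ⊥-elim (z∉Tv v≼z)
  inner-ancestors-pass (distOK _ passes _) _ (here refl) _ = passes
  inner-ancestors-pass {ℓ = ℓ} {ℓ₀ = ℓ₀} (ancHit _ _ (z′ , (v≼z′ , z′≼z) , labelled) r) unlabelled
                       (here refl) (_ , z≼t) =
    ⊥-elim (⊑-labelled {ℓ = ℓ} {ℓ₀} (inner-⊑ r) labelled
                       (unlabelled z′ (v≼z′ , desc-trans T z′≼z z≼t)))
  inner-ancestors-pass {v} {ℓ} (mark {t = z} _ _ _ r) unlabelled (here refl) z∈A =
    ⊥-elim (just≢nothing (trans (sym (inner-⊑ r (update-self ℓ z (just v)))) (unlabelled z z∈A)))
  inner-ancestors-pass (notDesc _ r)    ul (there z∈pre) = inner-ancestors-pass r ul z∈pre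
  inner-ancestors-pass (distOK _ _ r)   ul (there z∈pre) = inner-ancestors-pass r ul z∈pre
  inner-ancestors-pass (ancHit _ _ _ r) ul (there z∈pre) = inner-ancestors-pass r ul z∈pre
  inner-ancestors-pass (mark _ _ _ r)   ul (there z∈pre) = inner-ancestors-pass r ul z∈pre

  outer-marking-pass : ∀ {L ℓ vs ℓ′ t a} → Outer L ℓ vs ℓ′ → ℓ t ≡ nothing → ℓ′ t ≡ just a →
    ∃ λ v → v ≢ s × ∃₂ λ ℓ₁ ℓ₂ → Inner v ℓ₁ L ℓ₂ × ℓ₁ t ≡ nothing × ℓ₂ t ≡ just a
  outer-marking-pass done e₁ e₂ = ⊥-elim (just≢nothing (trans (sym e₂) e₁))
  outer-marking-pass (root o) e₁ e₂ = outer-marking-pass o e₁ e₂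
  outer-marking-pass {ℓ = ℓ} {t = t} (edge {v = v} {ℓ₁ = ℓ₁} v≢s i o) e₁ e₂ with ℓ₁ t in eq
  ... | nothing = outer-marking-pass o eq e₂
  ... | just b  = v , v≢s , ℓ , ℓ₁ , i , e₁ , trans eq (trans (sym (outer-⊑ o eq)) e₂)

  record Marked (v t : Fin n) : Set where
    field
      v≢s            : v ≢ s
      t∈Tv           : Desc T v t
      fails-test     : ¬ DistTest v t
      ancestors-pass : ∀ z → InA T v t z → z ≢ t → DistTest v z

  result-marked : ∀ {L ℓ v t} → PreList T s L → Result L ℓ → ℓ t ≡ just v → Marked v t
  result-marked {L} {t = t} preorder result ℓt≡v with outer-marking-pass result refl ℓt≡v
  ... | v , v≢s , ℓ₁ , ℓ₂ , run , e₁ , e₂ with inner-marking-step run e₁ e₂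
  ... | refl , m = record
    { v≢s = v≢s ; t∈Tv = t∈Tv ; fails-test = fails-test
    ; ancestors-pass = λ z z∈A z≢t → inner-ancestors-pass run-pre A-unlabelled (earlier z∈A z≢t) z∈A
    }
    where
    open MarkingStep m
    earlier : ∀ {z} → InA T v t z → z ≢ t → z ∈ pre
    earlier (_ , z≼t) z≢t with preorder-ancestors-first T preorder pre t post xs≡pre+t+post z≼t z≢t
    ... | inj₁ z∈pre       = z∈pre
    ... | inj₂ (z≼s , z≢s) = ⊥-elim (¬proper-ancestor-root T z≼s z≢s)

module _ {n} (G : Graph n) {s : Fin n} (T : RootedTree G s)
         {dG : Fin n → Fin n → ℚ} {dGe : Fin n → Fin n → Fin n → ℚ}
         (dG-dist : ∀ x y → IsDist (E G) (w G) x y (dG x y)) where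
  open MarkUp T dG dGe
  open WeightedWalks (E G) (w G) (w-nonneg G) using (dist-triangle)

  distTest-along-shortest : ∀ {v t z q} →
    (∀ x y → IsDist (Remove (E G) (parent T v) v) (w G) x y (dGe v x y)) →
    IsShortest (Remove (E G) (parent T v) v) (w G) s t q → z ∈ q →
    DistTest v z → DistTest v t
  distTest-along-shortest {v} {t} {z} {q} dGe-dist (q-path , q-min) z∈q z-passes = begin
    dGe v s v + dG v t              ≤⟨ ℚ.+-monoʳ-≤ (dGe v s v) triangle ⟩
    dGe v s v + (dG v z + dG z t)   ≡⟨ ℚ.+-assoc (dGe v s v) (dG v z) (dG z t) ⟨
    wP v z + dG z t                 ≤⟨ ℚ.+-mono-≤ z-passes dG≤2dGe ⟩
    (X + X) + (Y + Y)               ≡⟨ interchange X X Y Y ⟩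
    (X + Y) + (X + Y)               ≤⟨ ℚ.+-mono-≤ through-z through-z ⟩
    dGe v s t + dGe v s t           ∎
    where
    open ℚ.≤-Reasoning
    open WeightedWalks (Remove (E G) (parent T v) v) (w G) (w-nonneg G)
      using (dist-nonNeg; dist-through)
    X Y : ℚ
    X = dGe v s z
    Y = dGe v z t
    triangle : dG v t ≤ dG v z + dG z t
    triangle = dist-triangle (dG-dist v z) (dG-dist z t) (dG-dist v t)
    dG≤2dGe : dG z t ≤ Y + Y
    dG≤2dGe = ℚ.≤-trans (dist-mono proj₁ (dG-dist z t) (dGe-dist z t))
                        (p≤p+q (dist-nonNeg (dGe-dist z t)))
    through-z : X + Y ≤ dGe v s t
    through-z with proj₁ (dGe-dist s t)
    ... | p , p-path , wt≡dist =
      ℚ.≤-trans (dist-through q (dGe-dist s z) (dGe-dist z t) (path⇒walk q-path) z∈q)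
                (subst (_ ≤_) wt≡dist (q-min p p-path))

mainTheorem6 : ∀ {n} (G : Graph n) → TwoEdgeConnected G →
    (s : Fin n) (T : RootedTree G s) → IsSPT T →
    (dG : Fin n → Fin n → ℚ) → (∀ x y → IsDist (E G) (w G) x y (dG x y)) →
    (dGe : Fin n → Fin n → Fin n → ℚ) →
    (∀ v → v ≢ s → ∀ x y →
      IsDist (Remove (E G) (parent T v) v) (w G) x y (dGe v x y)) →
    (L : List (Fin n)) → PreList T s L →
    (ℓ : Label n) → MarkUp.Result T dG dGe L ℓ →
    ∀ v t → ℓ t ≡ just v →
    ∀ q → IsShortest (Remove (E G) (parent T v) v) (w G) s t q →
    ∀ p → Path (TE T) v t p →
    EdgeDisjoint q p
mainTheorem6 G _ s T _ dG dG-dist dGe dGe-dist L preorder ℓ result v t ℓt≡v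
             q q-shortest p p-path a b c d ab∈q cd∈p ab~cd
  with shared-edge⇒shared-vertex t ab∈q cd∈p ab~cd (TE⇒≢ T (consec⇒edge (proj₁ p-path) cd∈p))
... | z , z∈p , z∈q , z≢t =
  fails-test (distTest-along-shortest G T {dGe = dGe} dG-dist (dGe-dist v v≢s) q-shortest z∈q
               (ancestors-pass z (tree-path-InA T p-path t∈Tv z∈p) z≢t))
  where open MarkUpRun.Marked (MarkUpRun.result-marked T dG dGe preorder result ℓt≡v)
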